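{- Let $k\ge1$ and let $\beta$ be a parking preference of length $n$ whose weakly increasing rearrangement is the associated parking preference of a $k$-Dyck path $P$ (its corresponding $k$-Dyck path). Then every rearrangement of $\beta$ is a $k$-Naples parking function if and only if, whenever $P$ has a Down step which crosses below the line $y=0$ (from height $0$ to height $-1$), there is a point within the following $2k$ steps at which, counted from just after that Down step, there have been in total two more Up steps than Down steps.
   Context: A lattice path consists of Up steps $(1,1)$ and Down steps $(1,-1)$ starting at $(0,0)$. A $k$-Dyck path of length $n$ has $n$ Up and $n$ Down steps, never goes below $y=-k$, and ends with a Down step. Its associated parking preference is $(a_1,\dots,a_n)$ with $a_i$ equal to $1$ plus the number of Down steps preceding the $i$-th Up step. Parking rules: $n$ spots $1,\dots,n$, cars $c_1,\dots,c_n$ arrive in order with preferences $a_j\in[n]$; $k$-Naples rule: $c_j$ parks at $a_j$ if empty, otherwise checks $a_j-1,\dots,a_j-k$ (those $\ge1$) in order and parks in the first empty one, otherwise drives forward from $a_j$ and parks in the first empty spot after $a_j$ (failing if none). A preference is a $k$-Naples parking function if all cars park. -}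

module Defs where

open import Data.Nat using (ℕ; zero; suc; _+_; _∸_; _⊓_; _≤_; _≡ᵇ_)
open import Data.Nat.Properties using (≤-decTotalOrder)
open import Data.Integer using (ℤ; +_; -_) renaming (_-_ to _-ℤ_; _≤_ to _≤ℤ_)
open import Data.List using (List; []; _∷_; _++_; [_]; applyUpTo; length; take)
open import Data.Bool.ListAction using (any)
open import Data.Bool using (Bool; true; false; if_then_else_)
open import Data.Maybe using (Maybe; just; nothing)
open import Data.Product using (Σ; ∃; ∃-syntax; _×_)
open import Relation.Binary.PropositionalEquality using (_≡_)
import Data.List.Sort

data Step : Set where
  U D : Step

#U : List Step → ℕ
#U [] = 0
#U (U ∷ ps) = suc (#U ps)
#U (D ∷ ps) = #U ps

#D : List Step → ℕ
#D [] = 0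
#D (U ∷ ps) = #D ps
#D (D ∷ ps) = suc (#D ps)

height : List Step → ℤ
height ps = + #U ps -ℤ + #D ps

record IsKDyck (k n : ℕ) (P : List Step) : Set where
  field
    ups      : #U P ≡ n
    downs    : #D P ≡ n
    aboveMin : ∀ xs ys → P ≡ xs ++ ys → - (+ k) ≤ℤ height xs
    lastDown : ∃[ xs ] P ≡ xs ++ [ D ]

-- associated parking preference: a_i = 1 + #Down steps preceding the i-th Up step
prefFrom : ℕ → List Step → List ℕ
prefFrom d [] = []
prefFrom d (U ∷ ps) = suc d ∷ prefFrom d ps
prefFrom d (D ∷ ps) = prefFrom (suc d) ps

pref : List Step → List ℕ
pref = prefFrom 0

IsParkingPreference : ℕ → List ℕ → Set
IsParkingPreference n β = length β ≡ n × (∀ {a} → a ∈ β → 1 ≤ a × a ≤ n)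
  where open import Data.List.Membership.Propositional using (_∈_)

open Data.List.Sort ≤-decTotalOrder using (sort) public

-- k-Naples rule: the ordered list of spots a car preferring a tries:
-- a, then a-1, ..., a-k (those ≥ 1), then a+1, ..., n.
candidates : ℕ → ℕ → ℕ → List ℕ
candidates n k a =
  a ∷ (applyUpTo (λ i → a ∸ suc i) (k ⊓ (a ∸ 1)) ++ applyUpTo (λ i → a + suc i) (n ∸ a))

occupied : ℕ → List ℕ → Bool
occupied s occ = any (λ t → s ≡ᵇ t) occ

firstFree : List ℕ → List ℕ → Maybe ℕ
firstFree occ [] = nothing
firstFree occ (c ∷ cs) = if occupied c occ then firstFree occ cs else just c

parksAll : ℕ → ℕ → List ℕ → List ℕ → Bool
parksAll n k occ [] = true
parksAll n k occ (a ∷ as) with firstFree occ (candidates n k a)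
... | just s  = parksAll n k (s ∷ occ) as
... | nothing = false

IsKNaplesPF : ℕ → ℕ → List ℕ → Set
IsKNaplesPF k n α = IsParkingPreference n α × parksAll n k [] α ≡ true

CrossingCondition : ℕ → List Step → Set
CrossingCondition k P =
  ∀ xs ys → P ≡ xs ++ (D ∷ ys) → height xs ≡ + 0 →
    ∃[ j ] (1 ≤ j × j ≤ 2 Data.Nat.* k × j ≤ length ys ×
            #U (take j ys) ≡ #D (take j ys) + 2)

-- Write S j for the number of cars preferring a spot ≤ j.  If xs is the part of P before its
-- (i + 1)-st Down step, then S (i + 1) = #U xs, so S (i + 1) = i says that this step goes from
-- height 0 to height −1.
--
-- (⇐) Suppose some car gets stuck and let e be the greatest vacant spot.  The stuck car prefers a
-- spot beyond e + k; every spot above e is taken, and only by cars preferring a spot above e; and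
-- cars preferring a spot in (e, j] with j ≤ e + k park in (e, j].  Counting gives S e < e and
-- S j < j for e < j ≤ e + k.  But going down from e to the first j′ with S j′ = j′ − 1 reaches a
-- Down step from height 0, and the surplus of two Up steps that the crossing condition provides
-- after it yields some j in (e, e + k] with S j ≥ j.
--
-- (⇒) If the Down step after xs crosses y = 0 and is not followed by such a surplus, let the cars
-- whose preferences come after that step, all above i = #D xs + 1, park first.  While a preference
-- p is at most i + k, at most p − i − 1 of them have parked, so some vacant spot in (i, p] is within
-- reach behind p; a larger preference leads to a spot above p − k > i.  So all n − i + 1 of these
-- cars would park in the n − i spots above i.

module Submission where

open import Defs

open import Data.Bool using (true; false; T)
open import Data.Empty using (⊥; ⊥-elim)
open import Data.Fin using (Fin; toℕ; fromℕ<)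
open import Data.Fin.Properties using (any?; toℕ-fromℕ<)
import Data.Integer as ℤ
import Data.Integer.Properties as ℤ
open import Data.List using (List; []; _∷_; _++_; length; filter; applyUpTo; take; drop)
open import Data.List.Membership.Propositional using (_∈_; _∉_)
open import Data.List.Membership.Propositional.Properties
  using (∈-∃++; ∈-++⁺ˡ; ∈-++⁺ʳ; ∈-++⁻; ∈-applyUpTo⁺; ∈-applyUpTo⁻; ∈-filter⁺; ∈-filter⁻)
open import Data.List.Properties
  using (length-++; length-++-sucʳ; ++-assoc; length-filter; filter-++; filter-all; filter-none; filter-reject;
         length-applyUpTo; length-take; take++drop≡id)
open import Data.List.Relation.Binary.Permutation.Propositional using (_↭_; ↭-trans; ↭-sym)
open import Data.List.Relation.Binary.Permutation.Propositional.Properties using (↭-length; filter-↭; ∈-resp-↭; ++-comm)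
open import Data.List.Relation.Binary.Subset.Propositional using (_⊆_)
open import Data.List.Relation.Unary.All as All using (All)
open import Data.List.Relation.Unary.All.Properties using (¬Any⇒All¬)
import Data.List.Relation.Unary.Any as Any
open import Data.List.Relation.Unary.Any using (here; there)
open import Data.List.Relation.Unary.Any.Properties using (any⁺; any⁻)
open import Data.List.Relation.Unary.Unique.Propositional using (Unique; []; _∷_)
open import Data.List.Relation.Unary.Unique.Propositional.Properties
  using (applyUpTo⁺₁) renaming (filter⁺ to Unique-filter⁺)
open import Data.Maybe using (Maybe; just; nothing)
open import Data.Nat using (ℕ; zero; suc; _+_; _*_; _∸_; _⊓_; _≤_; _<_; z≤n; s≤s; z<s; _≤?_; _<?_; _≟_)
open import Data.Nat.Properties
open import Data.Nat.Tactic.RingSolver using (solve-∀)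
open import Data.List.Membership.DecPropositional _≟_ using (_∈?_)
open import Data.List.Sort ≤-decTotalOrder using (sort-↭)
open import Data.Product using (∃; ∃-syntax; _×_; _,_; proj₁; proj₂; map₁)
open import Data.Sum using (_⊎_; inj₁; inj₂; [_,_]′)
open import Data.Unit using (tt)
open import Function using (_∘_; _⇔_; mk⇔)
open import Level using (0ℓ)
open import Relation.Binary.Definitions using (tri<; tri≈; tri>)
open import Relation.Binary.PropositionalEquality
open import Relation.Nullary using (¬_; Dec; yes; no)
open import Relation.Nullary.Decidable using (_×-dec_)
open import Relation.Unary using (Pred; Decidable; ∁)
open import Relation.Unary.Properties using (∁?)

module _ {A : Set} where

  count : {P : Pred A 0ℓ} → Decidable P → List A → ℕ
  count P? = length ∘ filter P?

  module _ {P : Pred A 0ℓ} (P? : Decidable P) where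

    count-++ : ∀ xs ys → count P? (xs ++ ys) ≡ count P? xs + count P? ys
    count-++ xs ys = trans (cong length (filter-++ P? xs ys)) (length-++ (filter P? xs))

    count-↭ : ∀ {xs ys} → xs ↭ ys → count P? xs ≡ count P? ys
    count-↭ = ↭-length ∘ filter-↭ P?

    count≤length : ∀ xs → count P? xs ≤ length xs
    count≤length = length-filter P?

    count-complement : ∀ xs → count P? xs + count (∁? P?) xs ≡ length xs
    count-complement [] = refl
    count-complement (x ∷ xs) with P? x
    ... | yes _ = cong suc (count-complement xs)
    ... | no _  = trans (+-suc _ _) (cong suc (count-complement xs))

  module _ {P Q : Pred A 0ℓ} (P? : Decidable P) (Q? : Decidable Q) where

    count-mono : (∀ {x} → P x → Q x) → ∀ xs → count P? xs ≤ count Q? xs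
    count-mono P⇒Q [] = z≤n
    count-mono P⇒Q (x ∷ xs) with P? x | Q? x
    ... | yes _ | yes _ = s≤s (count-mono P⇒Q xs)
    ... | yes p | no ¬q = ⊥-elim (¬q (P⇒Q p))
    ... | no _  | yes _ = m≤n⇒m≤1+n (count-mono P⇒Q xs)
    ... | no _  | no _  = count-mono P⇒Q xs

    count-≤-+ : {R : Pred A 0ℓ} (R? : Decidable R) → (∀ {x} → R x → P x ⊎ Q x) →
                ∀ xs → count R? xs ≤ count P? xs + count Q? xs
    count-≤-+ R? R⇒P⊎Q [] = z≤n
    count-≤-+ R? R⇒P⊎Q (x ∷ xs) with ih ← count-≤-+ R? R⇒P⊎Q xs | R? x | P? x | Q? x
    ... | no _  | no _  | no _  = ih
    ... | no _  | no _  | yes _ = ≤-trans ih (+-monoʳ-≤ _ (n≤1+n _))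
    ... | no _  | yes _ | no _  = m≤n⇒m≤1+n ih
    ... | no _  | yes _ | yes _ = m≤n⇒m≤1+n (≤-trans ih (+-monoʳ-≤ _ (n≤1+n _)))
    ... | yes _ | yes _ | no _  = s≤s ih
    ... | yes _ | yes _ | yes _ = s≤s (≤-trans ih (+-monoʳ-≤ _ (n≤1+n _)))
    ... | yes _ | no _  | yes _ = ≤-trans (s≤s ih) (≤-reflexive (sym (+-suc _ _)))
    ... | yes r | no ¬p | no ¬q = [ ⊥-elim ∘ ¬p , ⊥-elim ∘ ¬q ]′ (R⇒P⊎Q r)

bounded-∃? : ∀ {Q : Pred ℕ 0ℓ} m → Decidable Q → (∀ {j} → Q j → j ≤ m) → Dec (∃ Q)
bounded-∃? {Q} m Q? bound with any? (λ (j : Fin (suc m)) → Q? (toℕ j))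
... | yes (j , q) = yes (toℕ j , q)
... | no ∄q = no λ (j , q) → ∄q (fromℕ< (s≤s (bound q)) , subst Q (sym (toℕ-fromℕ< _)) q)

applyUpTo-+ : ∀ {A : Set} (f : ℕ → A) p q → applyUpTo f (p + q) ≡ applyUpTo f p ++ applyUpTo (f ∘ (p +_)) q
applyUpTo-+ f zero    q = refl
applyUpTo-+ f (suc p) q = cong (f 0 ∷_) (applyUpTo-+ (f ∘ suc) p q)

applyUpTo-cong : ∀ {A : Set} {f g : ℕ → A} → (∀ i → f i ≡ g i) → ∀ m → applyUpTo f m ≡ applyUpTo g m
applyUpTo-cong f≗g zero    = refl
applyUpTo-cong f≗g (suc m) = cong₂ _∷_ (f≗g 0) (applyUpTo-cong (f≗g ∘ suc) m)

take-length-++ : ∀ {A : Set} (xs ys : List A) → take (length xs) (xs ++ ys) ≡ xs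
take-length-++ []       ys = refl
take-length-++ (x ∷ xs) ys = cong (x ∷_) (take-length-++ xs ys)

Unique-⊆⇒length≤ : ∀ {A : Set} {xs ys : List A} → Unique xs → xs ⊆ ys → length xs ≤ length ys
Unique-⊆⇒length≤ {xs = []} _ _ = z≤n
Unique-⊆⇒length≤ {xs = x ∷ xs} (x∉xs ∷ u) xs⊆ys with ∈-∃++ (xs⊆ys (here refl))
... | hs , ts , refl = ≤-trans (s≤s (Unique-⊆⇒length≤ u drop-x)) (≤-reflexive (sym (length-++-sucʳ hs x ts)))
  where
    drop-x : xs ⊆ hs ++ ts
    drop-x {y} y∈xs with ∈-++⁻ hs (xs⊆ys (there y∈xs))
    ... | inj₁ y∈hs         = ∈-++⁺ˡ y∈hs
    ... | inj₂ (here refl)  = ⊥-elim (All.lookup x∉xs y∈xs refl)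
    ... | inj₂ (there y∈ts) = ∈-++⁺ʳ hs y∈ts

count-∈≤length : {xs : List ℕ} → ∀ ys → Unique ys → count (_∈? xs) ys ≤ length xs
count-∈≤length {xs} ys u = Unique-⊆⇒length≤ (Unique-filter⁺ (_∈? xs) u) (proj₂ ∘ ∈-filter⁻ (_∈? xs) {xs = ys})

⊆⇒length≤count-∈ : {xs ys : List ℕ} → Unique xs → xs ⊆ ys → length xs ≤ count (_∈? xs) ys
⊆⇒length≤count-∈ {xs} u xs⊆ys = Unique-⊆⇒length≤ u (λ x∈xs → ∈-filter⁺ (_∈? xs) (xs⊆ys x∈xs) x∈xs)

interval : ℕ → ℕ → List ℕ
interval e j = applyUpTo (λ i → e + suc i) (j ∸ e)

module _ {e j : ℕ} where

  ∈-interval⁺ : ∀ {t} → e < t → t ≤ j → t ∈ interval e j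
  ∈-interval⁺ e<t t≤j with i , refl ← m≤n⇒∃[o]m+o≡n e<t =
    subst (_∈ interval e j) (+-suc e i)
      (∈-applyUpTo⁺ (λ i → e + suc i) (m+n≤o⇒m≤o∸n (suc i) (subst (_≤ j) (cong suc (+-comm e i)) t≤j)))

  ∈-interval⁻ : ∀ {t} → t ∈ interval e j → e < t × t ≤ j
  ∈-interval⁻ t∈ with i , i< , refl ← ∈-applyUpTo⁻ (λ i → e + suc i) t∈ =
    m<m+n e z<s , subst (_≤ j) (+-comm (suc i) e) (m≤o∸n⇒m+n≤o (suc i) e≤j i<)
    where
      e≤j : e ≤ j
      e≤j = <⇒≤ (m∸n≢0⇒n<m (≢-sym (<⇒≢ (≤-trans z<s i<))))

  length-interval : length (interval e j) ≡ j ∸ e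
  length-interval = length-applyUpTo (λ i → e + suc i) (j ∸ e)

  interval-unique : Unique (interval e j)
  interval-unique = applyUpTo⁺₁ (λ i → e + suc i) (j ∸ e)
                      (λ i<i′ _ → <⇒≢ i<i′ ∘ suc-injective ∘ +-cancelˡ-≡ e _ _)

interval⊆⇒length≤ : ∀ {e j o} → interval e j ⊆ o → j ∸ e ≤ length o
interval⊆⇒length≤ {e} {j} sub = subst (_≤ _) (length-interval {e} {j}) (Unique-⊆⇒length≤ (interval-unique {e} {j}) sub)

interval-extend : ∀ {e j occ} → suc j ∈ occ → interval e j ⊆ occ → interval e (suc j) ⊆ occ
interval-extend {e} {j} sj∈occ sub {u} u∈ with ∈-interval⁻ u∈ | u ≟ suc j
... | _         | yes refl = sj∈occ
... | e<u , u≤sj | no u≢sj = sub (∈-interval⁺ e<u (≤-pred (≤∧≢⇒< u≤sj u≢sj)))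

∉-interval : ∀ {e j u} → j ≤ e → u ∉ interval e j
∉-interval j≤e u∈ with e<u , u≤j ← ∈-interval⁻ u∈ = <⇒≱ (<-≤-trans e<u u≤j) j≤e

greatest-vacant : ∀ occ e j → interval e j ⊆ occ ⊎
                  ∃[ t ] (e < t × t ≤ j × t ∉ occ × interval t j ⊆ occ)
greatest-vacant occ e zero = inj₁ (⊥-elim ∘ ∉-interval z≤n)
greatest-vacant occ e (suc j) with suc j ∈? occ | e <? suc j
... | no sj∉occ  | yes e<sj = inj₂ (suc j , e<sj , ≤-refl , sj∉occ , ⊥-elim ∘ ∉-interval {suc j} ≤-refl)
... | no _       | no e≮sj  = inj₁ (⊥-elim ∘ ∉-interval (≮⇒≥ e≮sj))
... | yes sj∈occ | _ with greatest-vacant occ e j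
...   | inj₁ sub = inj₁ (interval-extend sj∈occ sub)
...   | inj₂ (t , e<t , t≤j , t∉occ , sub) = inj₂ (t , e<t , m≤n⇒m≤1+n t≤j , t∉occ , interval-extend sj∈occ sub)

interval-++ : ∀ {e j m} → e ≤ j → j ≤ m → interval e m ≡ interval e j ++ interval j m
interval-++ {e} {j} {m} e≤j j≤m = begin
  applyUpTo f (m ∸ e)                         ≡⟨ cong (applyUpTo f) m∸e≡ ⟩
  applyUpTo f ((j ∸ e) + (m ∸ j))             ≡⟨ applyUpTo-+ f (j ∸ e) (m ∸ j) ⟩
  interval e j ++ applyUpTo (f ∘ ((j ∸ e) +_)) (m ∸ j) ≡⟨ cong (interval e j ++_) (applyUpTo-cong shift (m ∸ j)) ⟩
  interval e j ++ interval j m                ∎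
  where
    open ≡-Reasoning
    f : ℕ → ℕ
    f i = e + suc i
    m∸e≡ : m ∸ e ≡ (j ∸ e) + (m ∸ j)
    m∸e≡ = trans (cong (_∸ e) (sym (trans (sym (+-assoc e (j ∸ e) (m ∸ j)))
                                          (trans (cong (_+ (m ∸ j)) (m+[n∸m]≡n e≤j)) (m+[n∸m]≡n j≤m)))))
                 (m+n∸m≡n e _)
    shift : ∀ i → e + suc ((j ∸ e) + i) ≡ j + suc i
    shift i = trans (cong (e +_) (sym (+-suc (j ∸ e) i)))
                    (trans (sym (+-assoc e (j ∸ e) (suc i))) (cong (_+ suc i) (m+[n∸m]≡n e≤j)))

-- candidates n k a unfolds to a ∷ (lookback k a ++ interval a n).
lookback : ℕ → ℕ → List ℕ
lookback k a = applyUpTo (λ i → a ∸ suc i) (k ⊓ (a ∸ 1))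

module _ {k a : ℕ} where

  ∈-lookback⁻ : ∀ {t} → t ∈ lookback k a → t < a × a ≤ t + k
  ∈-lookback⁻ t∈ with i , i< , refl ← ∈-applyUpTo⁻ (λ i → a ∸ suc i) t∈ =
    ∸-monoʳ-< z<s si≤a , subst (_≤ a ∸ suc i + k) (m∸n+n≡m si≤a) (+-monoʳ-≤ (a ∸ suc i) si≤k)
    where
      si≤k : suc i ≤ k
      si≤k = ≤-trans i< (m⊓n≤m k (a ∸ 1))
      si≤a : suc i ≤ a
      si≤a = ≤-trans (≤-trans i< (m⊓n≤n k (a ∸ 1))) (m∸n≤m a 1)

  ∈-lookback⁺ : ∀ {t} → 1 ≤ t → t < a → a ≤ t + k → t ∈ lookback k a
  ∈-lookback⁺ {t} 1≤t t<a a≤t+k with p , refl ← m≤n⇒∃[o]m+o≡n t<a =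
    subst (_∈ lookback k a) (m+n∸n≡m t p) (∈-applyUpTo⁺ (λ i → a ∸ suc i) (⊓-glb p<k (m<n+m p 1≤t)))
    where
      p<k : p < k
      p<k = +-cancelˡ-≤ t (suc p) k (subst (_≤ t + k) (sym (+-suc t p)) a≤t+k)

lookback-prefix : ∀ {j k a} → j ≤ k → ∃[ rest ] lookback k a ≡ lookback j a ++ rest
lookback-prefix {j} {k} {a} j≤k with r , r≡ ← m≤n⇒∃[o]m+o≡n (⊓-monoˡ-≤ (a ∸ 1) j≤k) =
  _ , trans (cong (applyUpTo (λ i → a ∸ suc i)) (sym r≡)) (applyUpTo-+ (λ i → a ∸ suc i) (j ⊓ (a ∸ 1)) r)

module _ {n k a : ℕ} where

  ∈-candidates⁻ : ∀ {s} → s ∈ candidates n k a → (s ≤ a × a ≤ s + k) ⊎ (a < s × s ≤ n)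
  ∈-candidates⁻ (here refl) = inj₁ (≤-refl , m≤m+n a k)
  ∈-candidates⁻ (there s∈) with ∈-++⁻ (lookback k a) s∈
  ... | inj₁ s∈lookback = inj₁ (map₁ <⇒≤ (∈-lookback⁻ s∈lookback))
  ... | inj₂ s∈interval = inj₂ (∈-interval⁻ s∈interval)

  ∈-candidates⁺ : ∀ {t} → 1 ≤ t → t ≤ n → a ≤ t + k → t ∈ candidates n k a
  ∈-candidates⁺ {t} 1≤t t≤n a≤t+k with <-cmp t a
  ... | tri< t<a _ _ = there (∈-++⁺ˡ (∈-lookback⁺ 1≤t t<a a≤t+k))
  ... | tri≈ _ refl _ = here refl
  ... | tri> _ _ a<t = there (∈-++⁺ʳ (lookback k a) (∈-interval⁺ a<t t≤n))

  candidate-reach : ∀ {s} → s ∈ candidates n k a → a ≤ s + k × (a ≤ n → s ≤ n)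
  candidate-reach s∈ with ∈-candidates⁻ s∈
  ... | inj₁ (s≤a , a≤s+k) = a≤s+k , ≤-trans s≤a
  ... | inj₂ (a<s , s≤n)   = ≤-trans (<⇒≤ a<s) (m≤m+n _ k) , λ _ → s≤n

occupied⇒∈ : ∀ {s occ} → occupied s occ ≡ true → s ∈ occ
occupied⇒∈ {s} {occ} eq = Any.map (≡ᵇ⇒≡ s _) (any⁻ _ occ (subst T (sym eq) tt))

¬occupied⇒∉ : ∀ {s occ} → occupied s occ ≡ false → s ∉ occ
¬occupied⇒∉ {s} eq s∈occ = subst T eq (any⁺ _ (Any.map (≡⇒≡ᵇ s _) s∈occ))

module _ (occ : List ℕ) where

  firstFree-just : ∀ L {s} → firstFree occ L ≡ just s → s ∈ L × s ∉ occ
  firstFree-just (c ∷ cs) eq with occupied c occ in c-occ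
  ... | true = map₁ there (firstFree-just cs eq)
  firstFree-just (c ∷ cs) refl | false = here refl , ¬occupied⇒∉ c-occ

  firstFree-nothing : ∀ L → firstFree occ L ≡ nothing → L ⊆ occ
  firstFree-nothing (c ∷ cs) eq t∈ with occupied c occ in c-occ | t∈
  ... | true | here refl  = occupied⇒∈ c-occ
  ... | true | there t∈cs = firstFree-nothing cs eq t∈cs
  firstFree-nothing (c ∷ cs) () t∈ | false | _

  firstFree-++ : ∀ xs ys {s t} → firstFree occ (xs ++ ys) ≡ just s → t ∈ xs → t ∉ occ → s ∈ xs
  firstFree-++ (c ∷ cs) ys eq t∈ t∉occ with occupied c occ in c-occ | t∈
  ... | true | here refl  = ⊥-elim (t∉occ (occupied⇒∈ c-occ))
  ... | true | there t∈cs = there (firstFree-++ cs ys eq t∈cs t∉occ)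
  firstFree-++ (c ∷ cs) ys refl t∈ t∉occ | false | _ = here refl

module _ {n k : ℕ} where

  parks-≤-vacant-ahead : ∀ {occ a s e} → firstFree occ (candidates n k a) ≡ just s →
                         e ∉ occ → a ≤ e → e ≤ n → s ≤ e
  parks-≤-vacant-ahead {occ} {a} {s} {e} parked e∉occ a≤e e≤n =
    bound (firstFree-++ occ front (interval e n) parked′ e∈front e∉occ)
    where
      front : List ℕ
      front = a ∷ (lookback k a ++ interval a e)
      split : candidates n k a ≡ front ++ interval e n
      split = cong (a ∷_) (trans (cong (lookback k a ++_) (interval-++ a≤e e≤n))
                                 (sym (++-assoc (lookback k a) _ _)))
      parked′ : firstFree occ (front ++ interval e n) ≡ just s
      parked′ = subst (λ L → firstFree occ L ≡ just s) split parked
      e∈front : e ∈ front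
      e∈front with m≤n⇒m<n∨m≡n a≤e
      ... | inj₁ a<e  = there (∈-++⁺ʳ (lookback k a) (∈-interval⁺ a<e ≤-refl))
      ... | inj₂ refl = here refl
      bound : ∀ {t} → t ∈ front → t ≤ e
      bound (here refl) = a≤e
      bound (there t∈) with ∈-++⁻ (lookback k a) t∈
      ... | inj₁ t∈lookback = ≤-trans (<⇒≤ (proj₁ (∈-lookback⁻ t∈lookback))) a≤e
      ... | inj₂ t∈interval = proj₂ (∈-interval⁻ t∈interval)

  parks-between-vacant-behind : ∀ {occ a s e} → firstFree occ (candidates n k a) ≡ just s →
                                e ∉ occ → 1 ≤ e → e ≤ a → a ≤ e + k → e ≤ s × s ≤ a
  parks-between-vacant-behind {occ} {a} {s} {e} parked e∉occ 1≤e e≤a a≤e+k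
    with rest , lookback≡ ← lookback-prefix {a ∸ e} {k} {a} (m≤n+o⇒m∸n≤o a e a≤e+k) =
    bound (firstFree-++ occ front (rest ++ interval a n) parked′ e∈front e∉occ)
    where
      front : List ℕ
      front = a ∷ lookback (a ∸ e) a
      split : candidates n k a ≡ front ++ (rest ++ interval a n)
      split = cong (a ∷_) (trans (cong (_++ interval a n) lookback≡) (++-assoc (lookback (a ∸ e) a) rest _))
      parked′ : firstFree occ (front ++ (rest ++ interval a n)) ≡ just s
      parked′ = subst (λ L → firstFree occ L ≡ just s) split parked
      e∈front : e ∈ front
      e∈front with m≤n⇒m<n∨m≡n e≤a
      ... | inj₁ e<a  = there (∈-lookback⁺ 1≤e e<a (m≤n+m∸n a e))
      ... | inj₂ refl = here refl
      bound : ∀ {t} → t ∈ front → e ≤ t × t ≤ a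
      bound (here refl) = e≤a , ≤-refl
      bound (there t∈) with t<a , a≤t+a∸e ← ∈-lookback⁻ t∈ =
        +-cancelʳ-≤ (a ∸ e) e _ (subst (_≤ _ + (a ∸ e)) (sym (m+[n∸m]≡n e≤a)) a≤t+a∸e) , <⇒≤ t<a

run : ℕ → ℕ → List ℕ → List ℕ → Maybe (List ℕ)
run n k occ [] = just occ
run n k occ (a ∷ as) with firstFree occ (candidates n k a)
... | just s  = run n k (s ∷ occ) as
... | nothing = nothing

module _ {n k : ℕ} where

  parksAll-++-stuck : ∀ occ as bs → run n k occ as ≡ nothing → parksAll n k occ (as ++ bs) ≡ false
  parksAll-++-stuck occ (a ∷ as) bs stuck with firstFree occ (candidates n k a)
  ... | just s  = parksAll-++-stuck (s ∷ occ) as bs stuck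
  ... | nothing = refl

  parksAll≡false⇒stuck : ∀ occ as → parksAll n k occ as ≡ false →
    ∃[ A ] ∃[ a ] ∃[ R ] ∃[ o ] (as ≡ A ++ a ∷ R × run n k occ A ≡ just o ×
                                 firstFree o (candidates n k a) ≡ nothing)
  parksAll≡false⇒stuck occ (a ∷ as) fails with firstFree occ (candidates n k a) in parked
  ... | nothing = [] , a , as , occ , refl , refl , parked
  ... | just s with A , b , R , o , refl , ran , stuck ← parksAll≡false⇒stuck (s ∷ occ) as fails =
    a ∷ A , b , R , o , refl , ran′ , stuck
    where
      ran′ : run n k occ (a ∷ A) ≡ just o
      ran′ rewrite parked = ran

  run-⊇ : ∀ occ as {o} → run n k occ as ≡ just o → occ ⊆ o
  run-⊇ occ [] refl = λ t∈ → t∈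
  run-⊇ occ (a ∷ as) ran t∈ with firstFree occ (candidates n k a)
  ... | just s = run-⊇ (s ∷ occ) as ran (there t∈)

  run-unique : ∀ occ as {o} → Unique occ → run n k occ as ≡ just o → Unique o
  run-unique occ [] u refl = u
  run-unique occ (a ∷ as) u ran with firstFree occ (candidates n k a) in parked
  ... | just s = run-unique (s ∷ occ) as (¬Any⇒All¬ occ (proj₂ (firstFree-just occ (candidates n k a) parked)) ∷ u) ran

  run-length : ∀ occ as {o} → run n k occ as ≡ just o → length o ≡ length as + length occ
  run-length occ [] refl = refl
  run-length occ (a ∷ as) ran with firstFree occ (candidates n k a)
  ... | just s = trans (run-length (s ∷ occ) as ran) (+-suc (length as) (length occ))

  module _ {P : Pred ℕ 0ℓ} (P? : Decidable P) {e : ℕ} where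

    run-count-≤ : (∀ {occ a s} → firstFree occ (candidates n k a) ≡ just s → e ∉ s ∷ occ → P s → P a) →
                  ∀ occ as {o} → run n k occ as ≡ just o → e ∉ o → count P? o ≤ count P? occ + count P? as
    run-count-≤ step occ [] refl e∉o = m≤m+n _ _
    run-count-≤ step occ (a ∷ as) ran e∉o with firstFree occ (candidates n k a) in parked
    ... | just s with P? s | P? a | run-count-≤ step (s ∷ occ) as ran e∉o
    ...   | yes _  | yes _  | ih = ≤-trans ih (≤-reflexive (sym (+-suc _ _)))
    ...   | yes ps | no ¬pa | _  = ⊥-elim (¬pa (step parked (e∉o ∘ run-⊇ (s ∷ occ) as ran) ps))
    ...   | no _   | yes _  | ih = ≤-trans ih (+-monoʳ-≤ _ (n≤1+n _))
    ...   | no _   | no _   | ih = ih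

    run-count-≥ : (∀ {occ a s} → firstFree occ (candidates n k a) ≡ just s → e ∉ s ∷ occ → P a → P s) →
                  ∀ occ as {o} → run n k occ as ≡ just o → e ∉ o → count P? as + count P? occ ≤ count P? o
    run-count-≥ step occ [] refl e∉o = ≤-refl
    run-count-≥ step occ (a ∷ as) ran e∉o with firstFree occ (candidates n k a) in parked
    ... | just s with P? a | P? s | run-count-≥ step (s ∷ occ) as ran e∉o
    ...   | yes _  | yes _  | ih = ≤-trans (≤-reflexive (sym (+-suc _ _))) ih
    ...   | yes pa | no ¬ps | _  = ⊥-elim (¬ps (step parked (e∉o ∘ run-⊇ (s ∷ occ) as ran) pa))
    ...   | no _   | yes _  | ih = ≤-trans (+-monoʳ-≤ _ (n≤1+n _)) ih
    ...   | no _   | no _   | ih = ih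

#U-++ : ∀ xs ys → #U (xs ++ ys) ≡ #U xs + #U ys
#U-++ []       ys = refl
#U-++ (U ∷ xs) ys = cong suc (#U-++ xs ys)
#U-++ (D ∷ xs) ys = #U-++ xs ys

#D-++ : ∀ xs ys → #D (xs ++ ys) ≡ #D xs + #D ys
#D-++ []       ys = refl
#D-++ (U ∷ xs) ys = #D-++ xs ys
#D-++ (D ∷ xs) ys = cong suc (#D-++ xs ys)

length≡#U+#D : ∀ ps → length ps ≡ #U ps + #D ps
length≡#U+#D []       = refl
length≡#U+#D (U ∷ ps) = cong suc (length≡#U+#D ps)
length≡#U+#D (D ∷ ps) = trans (cong suc (length≡#U+#D ps)) (sym (+-suc (#U ps) (#D ps)))

height≡0⇒#U≡#D : ∀ ps → height ps ≡ ℤ.+ 0 → #U ps ≡ #D ps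
height≡0⇒#U≡#D ps h = ℤ.+-injective (ℤ.i-j≡0⇒i≡j (ℤ.+ #U ps) (ℤ.+ #D ps) h)

#U≡#D⇒height≡0 : ∀ ps → #U ps ≡ #D ps → height ps ≡ ℤ.+ 0
#U≡#D⇒height≡0 ps eq = ℤ.i≡j⇒i-j≡0 (cong ℤ.+_ eq)

split-at-D : ∀ ps i → i < #D ps → ∃[ xs ] ∃[ ys ] (ps ≡ xs ++ D ∷ ys × #D xs ≡ i)
split-at-D (U ∷ ps) i i< with xs , ys , refl , eq ← split-at-D ps i i< = U ∷ xs , ys , refl , eq
split-at-D (D ∷ ps) zero    _        = [] , ps , refl , refl
split-at-D (D ∷ ps) (suc i) (s≤s i<) with xs , ys , refl , eq ← split-at-D ps i i< = D ∷ xs , ys , refl , cong suc eq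

prefix-with-surplus : ∀ c ps → c + #D ps ≤ #U ps → ∃[ xs ] ∃[ ys ] (ps ≡ xs ++ ys × #U xs ≡ #D xs + c)
prefix-with-surplus zero ps _ = [] , ps , refl , refl
prefix-with-surplus (suc c) (U ∷ ps) (s≤s le) with xs , ys , refl , eq ← prefix-with-surplus c ps le =
  U ∷ xs , ys , refl , trans (cong suc eq) (sym (+-suc (#D xs) c))
prefix-with-surplus (suc c) (D ∷ ps) le
  with xs , ys , refl , eq ← prefix-with-surplus (suc (suc c)) ps (subst (_≤ #U ps) (cong suc (+-suc c (#D ps))) le) =
  D ∷ xs , ys , refl , trans eq (+-suc (#D xs) (suc c))

length-surplus-2 : ∀ ps → #U ps ≡ #D ps + 2 → length ps ≡ 2 * suc (#D ps)
length-surplus-2 ps eq = trans (length≡#U+#D ps) (trans (cong (_+ #D ps) eq) (double (#D ps)))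
  where
    double : ∀ d → d + 2 + d ≡ 2 * suc d
    double = solve-∀

prefFrom-++ : ∀ d xs ys → prefFrom d (xs ++ ys) ≡ prefFrom d xs ++ prefFrom (d + #D xs) ys
prefFrom-++ d []       ys = cong (λ m → prefFrom m ys) (sym (+-identityʳ d))
prefFrom-++ d (U ∷ xs) ys = cong (suc d ∷_) (prefFrom-++ d xs ys)
prefFrom-++ d (D ∷ xs) ys = trans (prefFrom-++ (suc d) xs ys)
                                  (cong (λ m → prefFrom (suc d) xs ++ prefFrom m ys) (sym (+-suc d (#D xs))))

length-prefFrom : ∀ d ps → length (prefFrom d ps) ≡ #U ps
length-prefFrom d []       = refl
length-prefFrom d (U ∷ ps) = cong suc (length-prefFrom d ps)
length-prefFrom d (D ∷ ps) = length-prefFrom (suc d) ps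

prefFrom-bounds : ∀ d ps → All (λ x → d < x × x ≤ suc (d + #D ps)) (prefFrom d ps)
prefFrom-bounds d []       = All.[]
prefFrom-bounds d (U ∷ ps) = (≤-refl , s≤s (m≤m+n d _)) All.∷ prefFrom-bounds d ps
prefFrom-bounds d (D ∷ ps) = All.map weaken (prefFrom-bounds (suc d) ps)
  where
    weaken : ∀ {x} → suc d < x × x ≤ suc (suc d + #D ps) → d < x × x ≤ suc (d + #D (D ∷ ps))
    weaken {x} (d<x , x≤) = <-trans (n<1+n d) d<x , subst (λ m → x ≤ suc m) (sym (+-suc d (#D ps))) x≤

count-≤-prefFrom : ∀ d ps {j} → suc (d + #D ps) ≤ j → count (_≤? j) (prefFrom d ps) ≡ #U ps
count-≤-prefFrom d ps bound =
  trans (cong length (filter-all (_≤? _) (All.map (λ b → ≤-trans (proj₂ b) bound) (prefFrom-bounds d ps))))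
        (length-prefFrom d ps)

count-≤-prefFrom-none : ∀ d ps → count (_≤? d) (prefFrom d ps) ≡ 0
count-≤-prefFrom-none d ps = cong length (filter-none (_≤? d) (All.map (<⇒≱ ∘ proj₁) (prefFrom-bounds d ps)))

SurplusTwoWithin : ℕ → List Step → Set
SurplusTwoWithin k ys = ∃[ j ] (1 ≤ j × j ≤ 2 * k × j ≤ length ys × #U (take j ys) ≡ #D (take j ys) + 2)

SurplusTwoWithin? : ∀ k ys → Dec (SurplusTwoWithin k ys)
SurplusTwoWithin? k ys = bounded-∃? (2 * k)
  (λ j → (1 ≤? j) ×-dec (j ≤? 2 * k) ×-dec (j ≤? length ys) ×-dec (#U (take j ys) ≟ #D (take j ys) + 2))
  (proj₁ ∘ proj₂)

no-early-surplus : ∀ {k} ys → ¬ SurplusTwoWithin k ys →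
                   ∀ zs rs → ys ≡ zs ++ rs → #D zs < k → #U zs ≤ suc (#D zs)
no-early-surplus {k} _ none zs rs refl #D<k with #U zs ≤? suc (#D zs)
... | yes ok = ok
... | no excess with z₁ , z₂ , refl , surplus ← prefix-with-surplus 2 zs (≰⇒> excess) =
  ⊥-elim (none (length z₁ , 1≤len , len≤2k , len≤ , subst (λ L → #U L ≡ #D L + 2) (sym take≡) surplus))
  where
    len≡ : length z₁ ≡ 2 * suc (#D z₁)
    len≡ = length-surplus-2 z₁ surplus
    1≤len : 1 ≤ length z₁
    1≤len = subst (1 ≤_) (sym len≡) (s≤s z≤n)
    len≤2k : length z₁ ≤ 2 * k
    len≤2k = subst (_≤ 2 * k) (sym len≡)
               (*-monoʳ-≤ 2 (≤-<-trans (subst (#D z₁ ≤_) (sym (#D-++ z₁ z₂)) (m≤m+n _ _)) #D<k))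
    ys≡ : (z₁ ++ z₂) ++ rs ≡ z₁ ++ (z₂ ++ rs)
    ys≡ = ++-assoc z₁ z₂ rs
    len≤ : length z₁ ≤ length ((z₁ ++ z₂) ++ rs)
    len≤ = subst (λ L → length z₁ ≤ length L) (sym ys≡) (subst (length z₁ ≤_) (sym (length-++ z₁)) (m≤m+n _ _))
    take≡ : take (length z₁) ((z₁ ++ z₂) ++ rs) ≡ z₁
    take≡ = trans (cong (take (length z₁)) ys≡) (take-length-++ z₁ (z₂ ++ rs))

module _ {k n : ℕ} {P : List Step} (P-dyck : IsKDyck k n P) where

  open IsKDyck P-dyck

  S : ℕ → ℕ
  S j = count (_≤? j) (pref P)

  S-before-D : ∀ {xs ys} → P ≡ xs ++ D ∷ ys → S (suc (#D xs)) ≡ #U xs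
  S-before-D {xs} {ys} refl = begin
    count (_≤? suc (#D xs)) (prefFrom 0 (xs ++ D ∷ ys))   ≡⟨ cong (count (_≤? _)) (prefFrom-++ 0 xs (D ∷ ys)) ⟩
    count (_≤? suc (#D xs)) (prefFrom 0 xs ++ prefFrom (suc (#D xs)) ys)
      ≡⟨ count-++ (_≤? _) (prefFrom 0 xs) _ ⟩
    count (_≤? suc (#D xs)) (prefFrom 0 xs) + count (_≤? suc (#D xs)) (prefFrom (suc (#D xs)) ys)
      ≡⟨ cong₂ _+_ (count-≤-prefFrom 0 xs ≤-refl) (count-≤-prefFrom-none (suc (#D xs)) ys) ⟩
    #U xs + 0                                              ≡⟨ +-identityʳ (#U xs) ⟩
    #U xs                                                  ∎
    where open ≡-Reasoning

  S-≥-prefix : ∀ {qs rs j} → P ≡ qs ++ rs → suc (#D qs) ≤ j → #U qs ≤ S j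
  S-≥-prefix {qs} {rs} {j} refl bound = begin
    #U qs                                          ≡⟨ sym (count-≤-prefFrom 0 qs bound) ⟩
    count (_≤? j) (prefFrom 0 qs)                  ≤⟨ m≤m+n _ _ ⟩
    count (_≤? j) (prefFrom 0 qs) + count (_≤? j) (prefFrom (#D qs) rs)
                                                   ≡⟨ sym (count-++ (_≤? j) (prefFrom 0 qs) _) ⟩
    count (_≤? j) (prefFrom 0 qs ++ prefFrom (#D qs) rs) ≡⟨ cong (count (_≤? j)) (sym (prefFrom-++ 0 qs rs)) ⟩
    S j                                            ∎
    where open ≤-Reasoning

  crossing⇒recovery : CrossingCondition k P → ∀ {i} → i < n → S (suc i) ≡ i →
                      ∃[ j ] (suc i < j × j ≤ suc i + k × j ≤ S j)
  crossing⇒recovery cc i<n S≡i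
    with xs , ys , P≡ , refl ← split-at-D P _ (subst (_ <_) (sym downs) i<n)
    with U≡D ← trans (sym (S-before-D P≡)) S≡i
    with j′ , _ , j′≤2k , j′≤len , surplus ← cc xs ys P≡ (#U≡#D⇒height≡0 xs U≡D) =
    suc (#D xs) + suc d , m<m+n _ z<s , +-monoʳ-≤ (suc (#D xs)) d<k ,
    subst (_≤ S (suc (#D xs) + suc d)) #U≡
      (S-≥-prefix {xs ++ D ∷ tk} P≡qs++ (≤-reflexive (cong suc (#D-++ xs (D ∷ tk)))))
    where
      tk : List Step
      tk = take j′ ys
      d : ℕ
      d = #D tk
      d<k : d < k
      d<k = *-cancelˡ-≤ 2 (subst (_≤ 2 * k) (trans (sym (trans (length-take j′ ys) (m≤n⇒m⊓n≡m j′≤len)))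
                                                    (length-surplus-2 tk surplus)) j′≤2k)
      P≡qs++ : P ≡ (xs ++ D ∷ tk) ++ drop j′ ys
      P≡qs++ = trans P≡ (trans (cong (λ zs → xs ++ D ∷ zs) (sym (take++drop≡id j′ ys)))
                               (sym (++-assoc xs (D ∷ tk) _)))
      #U≡ : #U (xs ++ D ∷ tk) ≡ suc (#D xs) + suc d
      #U≡ = begin
        #U (xs ++ D ∷ tk)       ≡⟨ #U-++ xs (D ∷ tk) ⟩
        #U xs + #U tk           ≡⟨ cong₂ _+_ U≡D (trans surplus (+-comm d 2)) ⟩
        #D xs + suc (suc d)     ≡⟨ +-suc (#D xs) (suc d) ⟩
        suc (#D xs) + suc d     ∎
        where open ≡-Reasoning

  1+#D≤n : ∀ {xs ys} → P ≡ xs ++ D ∷ ys → suc (#D xs) ≤ n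
  1+#D≤n {xs} {ys} P≡ = begin
    suc (#D xs)             ≤⟨ s≤s (m≤m+n (#D xs) (#D ys)) ⟩
    suc (#D xs + #D ys)     ≡⟨ sym (trans (#D-++ xs (D ∷ ys)) (+-suc (#D xs) (#D ys))) ⟩
    #D (xs ++ D ∷ ys)       ≡⟨ trans (cong #D (sym P≡)) downs ⟩
    n                       ∎
    where open ≤-Reasoning

  #U+#D≡n : ∀ {xs ys} → P ≡ xs ++ D ∷ ys → #U xs ≡ #D xs → #U ys + #D xs ≡ n
  #U+#D≡n {xs} {ys} P≡ balanced = begin
    #U ys + #D xs           ≡⟨ +-comm (#U ys) (#D xs) ⟩
    #D xs + #U ys           ≡⟨ cong (_+ #U ys) (sym balanced) ⟩
    #U xs + #U ys           ≡⟨ sym (#U-++ xs (D ∷ ys)) ⟩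
    #U (xs ++ D ∷ ys)       ≡⟨ trans (cong #U (sym P≡)) ups ⟩
    n                       ∎
    where open ≡-Reasoning

  S-mono : ∀ {i j} → i ≤ j → S i ≤ S j
  S-mono i≤j = count-mono (_≤? _) (_≤? _) (λ x≤i → ≤-trans x≤i i≤j) (pref P)

  deficit⇒recovery : CrossingCondition k P → ∀ e → e ≤ n → S e < e → ∃[ j ] (e < j × j ≤ e + k × j ≤ S j)
  deficit⇒recovery cc (suc e) e<n S<1+e with S (suc e) ≟ e
  ... | yes S≡e = crossing⇒recovery cc e<n S≡e
  ... | no  S≢e with S<e ← ≤∧≢⇒< (≤-pred S<1+e) S≢e
    with j , e<j , j≤e+k , j≤Sj ← deficit⇒recovery cc e (<⇒≤ e<n) (≤-<-trans (S-mono (n≤1+n e)) S<e) =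
    j , ≤∧≢⇒< e<j (λ { refl → <⇒≱ S<e (≤-trans (n≤1+n e) j≤Sj) }) , m≤n⇒m≤1+n j≤e+k , j≤Sj

module _ {n k i : ℕ} where

  parks-above : ∀ {o d s} → firstFree o (candidates n k (suc (d + i))) ≡ just s → suc (d + i) ≤ n →
                (d < k → length o ≤ d) → s ∈ interval i n
  parks-above {o} {d} {s} parked p≤n room with d <? k
  ... | no d≮k with p≤s+k , s≤n ← candidate-reach (proj₁ (firstFree-just o (candidates n k (suc (d + i))) parked)) =
    ∈-interval⁺ (+-cancelʳ-≤ k (suc i) s (≤-trans (s≤s i+k≤d+i) p≤s+k)) (s≤n p≤n)
    where
      i+k≤d+i : i + k ≤ d + i
      i+k≤d+i = subst (_≤ d + i) (+-comm k i) (+-monoˡ-≤ i (≮⇒≥ d≮k))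
  ... | yes d<k with greatest-vacant o i (suc (d + i))
  ...   | inj₁ full =
    ⊥-elim (<⇒≱ (s≤s (room d<k)) (subst (_≤ length o) p∸i≡ (interval⊆⇒length≤ {i} {suc (d + i)} full)))
    where
      p∸i≡ : suc (d + i) ∸ i ≡ suc d
      p∸i≡ = trans (+-∸-assoc 1 {d + i} (m≤n+m i d)) (cong suc (m+n∸n≡m d i))
  ...   | inj₂ (t , i<t , t≤p , t∉o , _)
    with p≤t+k ← subst (suc (d + i) ≤_) (+-comm k t) (≤-trans (+-monoˡ-≤ i d<k) (+-monoʳ-≤ k (<⇒≤ i<t)))
    with t≤s , s≤p ← parks-between-vacant-behind {n} {k} parked t∉o (≤-trans (s≤s z≤n) i<t) t≤p p≤t+k =
    ∈-interval⁺ (<-≤-trans i<t t≤s) (≤-trans s≤p p≤n)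

  all-park-above : ∀ ws d o {o′} → All (_≤ n) (prefFrom (d + i) ws) → All (_∈ interval i n) o →
                   (∀ zs rs → ws ≡ zs ++ rs → d + #D zs < k → length o + #U zs ≤ suc (d + #D zs)) →
                   run n k o (prefFrom (d + i) ws) ≡ just o′ → All (_∈ interval i n) o′
  all-park-above []       d o prefs≤n above _ refl = above
  all-park-above (D ∷ ws) d o prefs≤n above no-surplus ran =
    all-park-above ws (suc d) o prefs≤n above no-surplus′ ran
    where
      no-surplus′ : ∀ zs rs → ws ≡ zs ++ rs → suc d + #D zs < k → length o + #U zs ≤ suc (suc d + #D zs)
      no-surplus′ zs rs refl lt = subst (λ m → length o + #U zs ≤ suc m) (+-suc d (#D zs))
                                    (no-surplus (D ∷ zs) rs refl (subst (_< k) (sym (+-suc d (#D zs))) lt))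
  all-park-above (U ∷ ws) d o (p≤n All.∷ prefs≤n) above no-surplus ran
    with firstFree o (candidates n k (suc (d + i))) in parked
  ... | just s = all-park-above ws d (s ∷ o) prefs≤n (parks-above parked p≤n room All.∷ above) no-surplus′ ran
    where
      room : d < k → length o ≤ d
      room d<k = ≤-pred (subst₂ _≤_ (+-comm (length o) 1) (cong suc (+-identityʳ d))
                                    (no-surplus (U ∷ []) ws refl (subst (_< k) (sym (+-identityʳ d)) d<k)))
      no-surplus′ : ∀ zs rs → ws ≡ zs ++ rs → d + #D zs < k → suc (length o) + #U zs ≤ suc (d + #D zs)
      no-surplus′ zs rs refl lt = subst (_≤ suc (d + #D zs)) (+-suc (length o) (#U zs)) (no-surplus (U ∷ zs) rs refl lt)

IsParkingPreference-↭ : ∀ {n γ β} → γ ↭ β → IsParkingPreference n β → IsParkingPreference n γ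
IsParkingPreference-↭ γ↭β (length≡n , bounded) = trans (↭-length γ↭β) length≡n , bounded ∘ ∈-resp-↭ γ↭β

module _ {k n : ℕ} {β : List ℕ} (β-pp : IsParkingPreference n β)
         {P : List Step} (P-dyck : IsKDyck k n P) (sorted : sort β ≡ pref P) where

  pref↭β : pref P ↭ β
  pref↭β = subst (_↭ β) sorted (sort-↭ β)

  module _ {A : List ℕ} {a : ℕ} {R o : List ℕ} (γ↭β : A ++ a ∷ R ↭ β)
           (ran : run n k [] A ≡ just o) (stuck : firstFree o (candidates n k a) ≡ nothing) where

    length-A+R : length A + suc (length R) ≡ n
    length-A+R = trans (sym (length-++ A)) (trans (↭-length γ↭β) (proj₁ β-pp))

    vacancy : ∃[ e ] (0 < e × e ≤ n × e ∉ o × interval e n ⊆ o)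
    vacancy with greatest-vacant o 0 n
    ... | inj₂ vacant = vacant
    ... | inj₁ full = ⊥-elim (<⇒≱ length-A<n (≤-trans (interval⊆⇒length≤ {0} {n} full) (≤-reflexive length-o≡)))
      where
        length-A<n : length A < n
        length-A<n = subst (length A <_) length-A+R (m<m+n _ z<s)
        length-o≡ : length o ≡ length A
        length-o≡ = trans (run-length [] A ran) (+-identityʳ _)

    module _ {e : ℕ} (0<e : 0 < e) (e≤n : e ≤ n) (e∉o : e ∉ o) (above-full : interval e n ⊆ o) where

      out-of-reach : e + k < a
      out-of-reach with a ≤? e + k
      ... | yes a≤e+k = ⊥-elim (e∉o (firstFree-nothing o (candidates n k a) stuck (∈-candidates⁺ 0<e e≤n a≤e+k)))
      ... | no  a≰e+k = ≰⇒> a≰e+k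

      S-split : ∀ {x} → x ≤ e + k → S P-dyck x ≡ count (_≤? x) A + count (_≤? x) R
      S-split {x} x≤e+k = begin
        count (_≤? x) (pref P)       ≡⟨ count-↭ (_≤? x) (↭-trans pref↭β (↭-sym γ↭β)) ⟩
        count (_≤? x) (A ++ a ∷ R)   ≡⟨ count-++ (_≤? x) A (a ∷ R) ⟩
        count (_≤? x) A + count (_≤? x) (a ∷ R)
          ≡⟨ cong (λ ys → count (_≤? x) A + length ys)
                  (filter-reject (_≤? x) (<⇒≱ (≤-<-trans x≤e+k out-of-reach))) ⟩
        count (_≤? x) A + count (_≤? x) R ∎
        where open ≡-Reasoning

      many-prefer-above : n ∸ e ≤ count (∁? (_≤? e)) A
      many-prefer-above = begin
        n ∸ e                          ≡⟨ sym (length-interval {e} {n}) ⟩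
        length (interval e n)          ≤⟨ ⊆⇒length≤count-∈ (interval-unique {e} {n}) above-full ⟩
        count (_∈? interval e n) o     ≤⟨ count-mono (_∈? _) (∁? (_≤? e)) (<⇒≱ ∘ proj₁ ∘ ∈-interval⁻) o ⟩
        count (∁? (_≤? e)) o           ≤⟨ run-count-≤ (∁? (_≤? e)) parks-above-only-from-above [] A ran e∉o ⟩
        count (∁? (_≤? e)) A           ∎
        where
          open ≤-Reasoning
          parks-above-only-from-above : ∀ {occ a s} → firstFree occ (candidates n k a) ≡ just s →
                                        e ∉ s ∷ occ → ¬ s ≤ e → ¬ a ≤ e
          parks-above-only-from-above parked e∉ s≰e a≤e =
            s≰e (parks-≤-vacant-ahead {n} {k} parked (e∉ ∘ there) a≤e e≤n)

      deficit : count (_≤? e) A + length R < e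
      deficit = +-cancelʳ-≤ (n ∸ e) _ e (begin
        suc (count (_≤? e) A + length R) + (n ∸ e)  ≡⟨ shuffle (count (_≤? e) A) (length R) (n ∸ e) ⟩
        count (_≤? e) A + (n ∸ e) + suc (length R)  ≤⟨ +-monoˡ-≤ _ (+-monoʳ-≤ (count (_≤? e) A) many-prefer-above) ⟩
        count (_≤? e) A + count (∁? (_≤? e)) A + suc (length R)
                                                    ≡⟨ cong (_+ suc (length R)) (count-complement (_≤? e) A) ⟩
        length A + suc (length R)                   ≡⟨ length-A+R ⟩
        n                                           ≡⟨ sym (m+[n∸m]≡n e≤n) ⟩
        e + (n ∸ e)                                 ∎)
        where
          open ≤-Reasoning
          shuffle : ∀ x r y → suc (x + r) + y ≡ x + y + suc r
          shuffle = solve-∀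

      S-below : S P-dyck e < e
      S-below = begin-strict
        S P-dyck e                         ≡⟨ S-split (m≤m+n e k) ⟩
        count (_≤? e) A + count (_≤? e) R  ≤⟨ +-monoʳ-≤ (count (_≤? e) A) (count≤length _ R) ⟩
        count (_≤? e) A + length R         <⟨ deficit ⟩
        e                                  ∎
        where open ≤-Reasoning

      S-short : ∀ {j} → e < j → j ≤ e + k → S P-dyck j < j
      S-short {j} e<j j≤e+k = begin-strict
        S P-dyck j                            ≡⟨ S-split j≤e+k ⟩
        count (_≤? j) A + count (_≤? j) R     ≤⟨ +-mono-≤ split-A (count≤length _ R) ⟩
        count (_≤? e) A + (j ∸ e) + length R  ≡⟨ swap (count (_≤? e) A) (j ∸ e) (length R) ⟩
        count (_≤? e) A + length R + (j ∸ e)  <⟨ +-monoˡ-< (j ∸ e) deficit ⟩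
        e + (j ∸ e)                           ≡⟨ m+[n∸m]≡n (<⇒≤ e<j) ⟩
        j                                     ∎
        where
          open ≤-Reasoning
          swap : ∀ x y z → x + y + z ≡ x + z + y
          swap = solve-∀
          below-or-between : ∀ {x} → x ≤ j → x ≤ e ⊎ x ∈ interval e j
          below-or-between {x} x≤j with x ≤? e
          ... | yes x≤e = inj₁ x≤e
          ... | no  x≰e = inj₂ (∈-interval⁺ (≰⇒> x≰e) x≤j)
          parks-between : ∀ {occ a s} → firstFree occ (candidates n k a) ≡ just s →
                          e ∉ s ∷ occ → a ∈ interval e j → s ∈ interval e j
          parks-between parked e∉ a∈ with e<a , a≤j ← ∈-interval⁻ a∈
            with e≤s , s≤a ← parks-between-vacant-behind {n} {k} parked (e∉ ∘ there) 0<e (<⇒≤ e<a)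
                                                          (≤-trans a≤j j≤e+k) =
            ∈-interval⁺ (≤∧≢⇒< e≤s (e∉ ∘ here)) (≤-trans s≤a a≤j)
          few-prefer-between : count (_∈? interval e j) A ≤ j ∸ e
          few-prefer-between = begin
            count (_∈? interval e j) A      ≡⟨ +-identityʳ _ ⟨
            count (_∈? interval e j) A + 0  ≤⟨ run-count-≥ (_∈? interval e j) parks-between [] A ran e∉o ⟩
            count (_∈? interval e j) o      ≤⟨ count-∈≤length o (run-unique [] A [] ran) ⟩
            length (interval e j)           ≡⟨ length-interval {e} {j} ⟩
            j ∸ e                           ∎
          split-A : count (_≤? j) A ≤ count (_≤? e) A + (j ∸ e)
          split-A = ≤-trans (count-≤-+ (_≤? e) (_∈? interval e j) (_≤? j) below-or-between A)
                            (+-monoʳ-≤ (count (_≤? e) A) few-prefer-between)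

  stuck⇒¬crossing : CrossingCondition k P → ∀ {A a R o} → A ++ a ∷ R ↭ β →
                    run n k [] A ≡ just o → firstFree o (candidates n k a) ≡ nothing → ⊥
  stuck⇒¬crossing cc γ↭β ran stuck
    with e , 0<e , e≤n , e∉o , above-full ← vacancy γ↭β ran stuck
    with j , e<j , j≤e+k , j≤Sj ← deficit⇒recovery P-dyck cc e e≤n (S-below γ↭β ran stuck 0<e e≤n e∉o above-full) =
    <⇒≱ (S-short γ↭β ran stuck 0<e e≤n e∉o above-full e<j j≤e+k) j≤Sj

  crossing⇒all-park : CrossingCondition k P → (γ : List ℕ) → γ ↭ β → IsKNaplesPF k n γ
  crossing⇒all-park cc γ γ↭β = IsParkingPreference-↭ γ↭β β-pp , parks
    where
      parks : parksAll n k [] γ ≡ true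
      parks with parksAll n k [] γ in fails
      ... | true  = refl
      ... | false with A , a , R , o , refl , ran , stuck ← parksAll≡false⇒stuck [] γ fails =
        ⊥-elim (stuck⇒¬crossing cc γ↭β ran stuck)

  high-preferences-first-↭ : ∀ {xs ys} → P ≡ xs ++ D ∷ ys → prefFrom (suc (#D xs)) ys ++ prefFrom 0 xs ↭ β
  high-preferences-first-↭ {xs} {ys} P≡ = ↭-trans (++-comm (prefFrom (suc (#D xs)) ys) (prefFrom 0 xs))
                                          (subst (_↭ β) (trans (cong pref P≡) (prefFrom-++ 0 xs (D ∷ ys))) pref↭β)

  high-preferences-first-jam : ∀ {xs ys} → P ≡ xs ++ D ∷ ys → height xs ≡ ℤ.+ 0 → ¬ SurplusTwoWithin k ys →
                   parksAll n k [] (prefFrom (suc (#D xs)) ys ++ prefFrom 0 xs) ≡ false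
  high-preferences-first-jam {xs} {ys} P≡ flat none with run n k [] (prefFrom (suc (#D xs)) ys) in ran
  ... | nothing = parksAll-++-stuck [] (prefFrom (suc (#D xs)) ys) (prefFrom 0 xs) ran
  ... | just o  = ⊥-elim (<⇒≱ (∸-monoʳ-< (n<1+n (#D xs)) (1+#D≤n P-dyck P≡)) (begin
    n ∸ #D xs                               ≡⟨ cong (_∸ #D xs) remaining-ups ⟨
    #U ys + #D xs ∸ #D xs                   ≡⟨ m+n∸n≡m (#U ys) (#D xs) ⟩
    #U ys                                   ≡⟨ sym (length-prefFrom i ys) ⟩
    length (prefFrom i ys)                  ≡⟨ sym (trans (run-length {n} {k} [] (prefFrom i ys) ran) (+-identityʳ _)) ⟩
    length o                                ≤⟨ Unique-⊆⇒length≤ o-unique (All.lookup above) ⟩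
    length (interval i n)                   ≡⟨ length-interval {i} {n} ⟩
    n ∸ i                                   ∎))
    where
      open ≤-Reasoning
      i : ℕ
      i = suc (#D xs)
      pref≡ : pref P ≡ prefFrom 0 xs ++ prefFrom i ys
      pref≡ = trans (cong pref P≡) (prefFrom-++ 0 xs (D ∷ ys))
      prefs≤n : All (_≤ n) (prefFrom i ys)
      prefs≤n = All.tabulate λ x∈ → proj₂ (proj₂ β-pp (∈-resp-↭ pref↭β (subst (_ ∈_) (sym pref≡) (∈-++⁺ʳ _ x∈))))
      remaining-ups : #U ys + #D xs ≡ n
      remaining-ups = #U+#D≡n P-dyck P≡ (height≡0⇒#U≡#D xs flat)
      o-unique : Unique o
      o-unique = run-unique {n} {k} [] (prefFrom i ys) [] ran
      above : All (_∈ interval i n) o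
      above = all-park-above ys 0 [] prefs≤n All.[] (no-early-surplus ys none) ran

  all-park⇒crossing : ((γ : List ℕ) → γ ↭ β → IsKNaplesPF k n γ) → CrossingCondition k P
  all-park⇒crossing all-park xs ys P≡ flat with SurplusTwoWithin? k ys
  ... | yes surplus = surplus
  ... | no  none with () ← trans (sym (proj₂ (all-park _ (high-preferences-first-↭ P≡))))
                                (high-preferences-first-jam P≡ flat none)

corollary3p6 : (k n : ℕ) → 1 ≤ k → (β : List ℕ) → IsParkingPreference n β →
    (P : List Step) → IsKDyck k n P → sort β ≡ pref P →
    ((γ : List ℕ) → γ ↭ β → IsKNaplesPF k n γ) ⇔ CrossingCondition k P
-- The argument does not use 1 ≤ k.
corollary3p6 k n _ β β-pp P P-dyck sorted =
  mk⇔ (all-park⇒crossing β-pp P-dyck sorted) (crossing⇒all-park β-pp P-dyck sorted)
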